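{- Let $p$ be a prime, $q$ a power of $p$, and $m \in \mathbb{F}_q$. For $d \geq 1$ let $M_d = (a_{i,j})_{0 \le i,j \le p^d - 1}$ be the $p^d \times p^d$ matrix over $\mathbb{F}_q$ defined by $a_{i,0} = a_{0,j} = 1$ and $a_{i,j} = a_{i-1,j} + m\, a_{i-1,j-1} + a_{i,j-1}$ for $i,j \geq 1$, and let $F = M_1$. Then for all $d \geq 1$, \[ M_d = \varphi^{d-1}(F) \otimes \varphi^{d-2}(F) \otimes \dots \otimes \varphi(F) \otimes F. \]
   Context: $\varphi(x) = x^p$ is the Frobenius automorphism of $\mathbb{F}_q$; for a matrix $A = (a_{i,j})$, $\varphi(A) = (\varphi(a_{i,j}))$, and $\varphi^0(F) = F$. For matrices $A = (a_{i,j}) \in \mathcal{M}_{s\times t}$ and $B \in \mathcal{M}_{u \times v}$, the tensor product $A \otimes B \in \mathcal{M}_{su \times tv}$ is the matrix with block representation $(a_{i,j} B)$. An iterated product $A_1 \otimes A_2 \otimes \dots \otimes A_n$ means $((\dots(A_1 \otimes A_2)\otimes A_3)\dots)\otimes A_n$. For $d=1$ the right-hand side is just $F$. -}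

module Defs where

open import Level using (Level; _⊔_)
open import Algebra.Bundles using (CommutativeRing)
open import Data.Nat as ℕ using (ℕ; zero; suc; NonZero)
open import Data.Nat.DivMod using (_/_; _%_)
open import Data.Fin using (Fin)
open import Data.Product using (∃)
open import Function.Bundles using (Inverse)
open import Relation.Nullary using (¬_)
import Relation.Binary.PropositionalEquality as ≡

record IsFiniteFieldOfOrder {c ℓ : Level} (R : CommutativeRing c ℓ) (q : ℕ) : Set (c ⊔ ℓ) where
  open CommutativeRing R
  field
    one≉zero : ¬ (1# ≈ 0#)
    inverse  : ∀ x → ¬ (x ≈ 0#) → ∃ λ y → (x * y) ≈ 1#
    card     : Inverse (≡.setoid (Fin q)) setoid

module _ {c ℓ : Level} (R : CommutativeRing c ℓ) where
  open CommutativeRing R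

  -- Matrices are represented as ℕ → ℕ → Carrier; only the entries with
  -- indices below the stated dimension are meaningful.
  Mat : Set c
  Mat = ℕ → ℕ → Carrier

  pow : Carrier → ℕ → Carrier
  pow x zero    = 1#
  pow x (suc n) = x * pow x n

  φ : ℕ → Mat → Mat
  φ p A i j = pow (A i j) p

  φ^ : ℕ → ℕ → Mat → Mat
  φ^ p zero    A = A
  φ^ p (suc k) A = φ p (φ^ p k A)

  tensor : (u v : ℕ) → .{{NonZero u}} → .{{NonZero v}} → Mat → Mat → Mat
  tensor u v A B i j = A (i / u) (j / v) * B (i % u) (j % v)

  arr : Carrier → Mat
  arr m zero    j       = 1#
  arr m (suc i) zero    = 1#
  arr m (suc i) (suc j) = arr m i (suc j) + m * arr m i j + arr m (suc i) j

  -- M_d = (a_{i,j})_{0 ≤ i,j ≤ p^d - 1}; as an ℕ-indexed matrix it is arr m,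
  -- restricted to indices < p^d.  F = M_1.

  -- iter p F e s = φ^{s+e}(F) ⊗ φ^{s+e-1}(F) ⊗ … ⊗ φ^{s}(F), left-associated,
  -- a product of e+1 factors, each p × p.
  iter : (p : ℕ) → .{{NonZero p}} → Mat → ℕ → ℕ → Mat
  iter p F zero    s = φ^ p s F
  iter p F (suc e) s = tensor p p (iter p F e (suc s)) (φ^ p s F)

  rhs : (p : ℕ) → .{{NonZero p}} → Mat → ℕ → Mat
  rhs p F e = iter p F e 0

{-# OPTIONS --safe #-}

-- Write a = arr m, c = 1 + m and p = P + 1.  Pascal's rule gives the closed form
-- a i j = Σₖ C(i,k) C(j,k) cᵏ.  In characteristic p it shows that row p and column p
-- of a are constantly 1 below index p and, since C(P,k) ≡ (-1)ᵏ mod p, that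
-- m · a P P + 1 = m · Σ_{k<p} cᵏ + 1 = cᵖ = 1 + mᵖ.  With these boundary values the
-- recurrence, run block by block, propagates a (i + I p) (j + J p) = (a I J)ᵖ · a i j
-- for i, j < p, the block corners being handled by the additivity of x ↦ xᵖ.  As p-th
-- powers commute with products, induction on d unfolds this into the iterated
-- Kronecker product.
module Submission where

open import Defs
open import Level using (Level)
open import Algebra.Bundles using (CommutativeRing)
open import Data.Nat using (ℕ; suc; _∸_; _^_; _<_; _≤_; NonZero)
open import Data.Nat.Primality using (Prime)
open import Relation.Binary.PropositionalEquality using (_≡_)

open import Data.Nat as ℕ using (zero; z≤n; s≤s; z<s; s<s; _!)
import Data.Nat.Properties as ℕP
open import Data.Nat.Primality using (euclidsLemma; prime⇒nonZero; prime⇒nonTrivial)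
open import Data.Nat.Divisibility using (_∣_; divides; ∣⇒≤; m∣m*n; ∣m⇒∣m*n)
open import Data.Nat.DivMod using (_/_; _%_; m≡m%n+[m/n]*n; m%n<n; m<n*o⇒m/o<n; m/n*n≡m)
open import Data.Nat.Combinatorics using (_C_; nCk+nC[k+1]≡[n+1]C[k+1]; nCn≡1; k![n∸k]!∣n!)
open import Data.Nat.Combinatorics.Specification using (nCk≡n!/k![n-k]!; k>n⇒nCk≡0)
open import Data.Nat.Tactic.RingSolver using (solve-∀)
open import Data.Fin as Fin using (Fin; toℕ)
open import Data.Fin.Properties using (toℕ<n; toℕ-inject₁; toℕ-fromℕ)
open import Data.Fin.Permutation using (permutation)
open import Data.Product using (_,_)
open import Data.Sum using (inj₁; inj₂)
open import Data.Empty using (⊥-elim)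
open import Function using (_∘_; Inverse)
open import Relation.Nullary using (¬_; Dec; yes; no; contradiction)
open import Relation.Nullary.Decidable using (map′)
import Relation.Binary.PropositionalEquality as ≡

prime∤n! : ∀ {p n} → Prime p → n < p → ¬ p ∣ n !
prime∤n! {p} {zero} pr _ p∣1 =
  ℕP.<⇒≱ (ℕ.nonTrivial⇒n>1 p {{prime⇒nonTrivial pr}}) (∣⇒≤ p∣1)
prime∤n! {n = suc n} pr 1+n<p p∣[1+n]! with euclidsLemma (suc n) (n !) pr p∣[1+n]!
... | inj₁ p∣1+n = ℕP.<⇒≱ 1+n<p (∣⇒≤ p∣1+n)
... | inj₂ p∣n!  = prime∤n! pr (ℕP.<-trans (ℕP.n<1+n n) 1+n<p) p∣n!

nCk*k!*[n∸k]!≡n! : ∀ {n k} → k ≤ n → (n C k) ℕ.* (k ! ℕ.* (n ∸ k) !) ≡ n !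
nCk*k!*[n∸k]!≡n! {n} {k} k≤n = ≡.trans
  (≡.cong (ℕ._* (k ! ℕ.* (n ∸ k) !)) (nCk≡n!/k![n-k]! k≤n))
  (m/n*n≡m {{k ℕP.!* (n ∸ k) !≢0}} (k![n∸k]!∣n! k≤n))

prime∣pCk : ∀ {p k} → Prime p → 0 < k → k < p → p ∣ p C k
prime∣pCk {p@(suc P)} {k} pr 0<k k<p
  with euclidsLemma (p C k) (k ! ℕ.* (p ∸ k) !) pr
         (≡.subst (p ∣_) (≡.sym (nCk*k!*[n∸k]!≡n! (ℕP.<⇒≤ k<p))) (m∣m*n (P !)))
... | inj₁ p∣pCk = p∣pCk
... | inj₂ p∣k![p∸k]! with euclidsLemma (k !) ((p ∸ k) !) pr p∣k![p∸k]!
...   | inj₁ p∣k!     = contradiction p∣k! (prime∤n! pr k<p)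
...   | inj₂ p∣[p∸k]! = contradiction p∣[p∸k]! (prime∤n! pr (ℕP.∸-monoʳ-< 0<k (ℕP.<⇒≤ k<p)))

pascal-product : ∀ i j k →
  (suc i C suc k) ℕ.* (suc j C suc k) ℕ.+ (i C suc k) ℕ.* (j C suc k) ≡
  ((i C suc k) ℕ.* (suc j C suc k) ℕ.+ (suc i C suc k) ℕ.* (j C suc k)) ℕ.+ (i C k) ℕ.* (j C k)
pascal-product i j k
  rewrite ≡.sym (nCk+nC[k+1]≡[n+1]C[k+1] i k) | ≡.sym (nCk+nC[k+1]≡[n+1]C[k+1] j k) =
  expand (i C k) (i C suc k) (j C k) (j C suc k)
  where
  expand : ∀ x′ x y′ y →
    (x′ ℕ.+ x) ℕ.* (y′ ℕ.+ y) ℕ.+ x ℕ.* y ≡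
    (x ℕ.* (y′ ℕ.+ y) ℕ.+ (x′ ℕ.+ x) ℕ.* y) ℕ.+ x′ ℕ.* y′
  expand = solve-∀

module _ {r ℓ : Level} (R : CommutativeRing r ℓ) where
  open CommutativeRing R hiding (zero)
  open import Relation.Binary.Reasoning.Setoid setoid
  open import Algebra.Properties.Semiring.Mult semiring
    using (_×_; ×-congʳ; ×-homo-+; ×-assocˡ; ×-assoc-*; ×-comm-*; ×1-homo-*)
  open import Algebra.Properties.Semiring.Exp semiring using (^-congˡ) renaming (_^_ to _^ᴿ_)
  open import Algebra.Properties.CommutativeSemiring.Exp commutativeSemiring using (^-distrib-*)
  open import Algebra.Properties.CommutativeSemiring.Binomial commutativeSemiring
    renaming (theorem to binomial-theorem)
  open import Algebra.Properties.Semiring.Sum semiring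
    using (sum; sum-cong-≋; sum-cong-≗; sum-replicate; sum-replicate-zero; sum-init-last;
           ∑-distrib-+; ∑-permute; *-distribˡ-sum)
  open import Algebra.Properties.Group +-group using (∙-cancelʳ)
  open import Algebra.Properties.CommutativeSemigroup *-commutativeSemigroup using (x∙yz≈y∙xz)
  open import Algebra.Solver.Ring.NaturalCoefficients.Default commutativeSemiring

  sumTo : ℕ → (ℕ → Carrier) → Carrier
  sumTo n f = sum {n} (f ∘ toℕ)

  sumTo-cong : ∀ n {f g} → (∀ k → k < n → f k ≈ g k) → sumTo n f ≈ sumTo n g
  sumTo-cong n f≈g = sum-cong-≋ (λ i → f≈g (toℕ i) (toℕ<n i))

  sumTo-zero : ∀ n f → (∀ k → k < n → f k ≈ 0#) → sumTo n f ≈ 0#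
  sumTo-zero n f f≈0 = trans (sumTo-cong n f≈0) (sum-replicate-zero n)

  sumTo-+ : ∀ n f g → sumTo n (λ k → f k + g k) ≈ sumTo n f + sumTo n g
  sumTo-+ n f g = ∑-distrib-+ {n} (f ∘ toℕ) (g ∘ toℕ)

  sumTo-* : ∀ n x f → sumTo n (λ k → x * f k) ≈ x * sumTo n f
  sumTo-* n x f = sym (*-distribˡ-sum {n} x (f ∘ toℕ))

  sumTo-snoc : ∀ n f → sumTo (suc n) f ≈ sumTo n f + f n
  sumTo-snoc n f = trans (sum-init-last (f ∘ toℕ))
    (+-cong (reflexive (sum-cong-≗ {n} {y = f ∘ toℕ} (≡.cong f ∘ toℕ-inject₁)))
            (reflexive (≡.cong f (toℕ-fromℕ n))))

  sumTo-ends : ∀ n f → 0 < n → (∀ k → 0 < k → k < n → f k ≈ 0#) →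
               sumTo (suc n) f ≈ f 0 + f n
  sumTo-ends (suc n) f _ inner≈0 = +-congˡ (begin
    sumTo (suc n) (f ∘ suc)        ≈⟨ sumTo-snoc n (f ∘ suc) ⟩
    sumTo n (f ∘ suc) + f (suc n)  ≈⟨ +-congʳ (sumTo-zero n (f ∘ suc)
                                                   (λ k k<n → inner≈0 (suc k) z<s (s<s k<n))) ⟩
    0# + f (suc n)                 ≈⟨ +-identityˡ _ ⟩
    f (suc n)                      ∎)

  pow≈^ : ∀ x n → pow R x n ≈ x ^ᴿ n
  pow≈^ x zero    = refl
  pow≈^ x (suc n) = *-congˡ (pow≈^ x n)

  pow-congˡ : ∀ n {x y} → x ≈ y → pow R x n ≈ pow R y n
  pow-congˡ n {x} {y} x≈y = trans (pow≈^ x n) (trans (^-congˡ n x≈y) (sym (pow≈^ y n)))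

  pow-distrib-* : ∀ n x y → pow R (x * y) n ≈ pow R x n * pow R y n
  pow-distrib-* n x y = trans (pow≈^ (x * y) n)
    (trans (^-distrib-* x y n) (sym (*-cong (pow≈^ x n) (pow≈^ y n))))

  pow-1# : ∀ n → pow R 1# n ≈ 1#
  pow-1# zero    = refl
  pow-1# (suc n) = trans (*-identityˡ _) (pow-1# n)

  ×≈×1#* : ∀ n x → n × x ≈ (n × 1#) * x
  ×≈×1#* n x = sym (trans (×-assoc-* n 1# x) (×-congʳ n (*-identityˡ x)))

  ×1-homo-^ : ∀ n k → (n ^ k) × 1# ≈ pow R (n × 1#) k
  ×1-homo-^ n zero    = +-identityʳ 1#
  ×1-homo-^ n (suc k) = trans (×1-homo-* n (n ^ k)) (*-congˡ (×1-homo-^ n k))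

  sum≈0⇒square≈square : ∀ {x y} → x + y ≈ 0# → x * x ≈ y * y
  sum≈0⇒square≈square {x} {y} x+y≈0 = ∙-cancelʳ (x * y) _ _ (begin
    x * x + x * y  ≈⟨ sym (distribˡ x x y) ⟩
    x * (x + y)    ≈⟨ trans (*-congˡ x+y≈0) (zeroʳ x) ⟩
    0#             ≈⟨ sym (trans (*-congʳ x+y≈0) (zeroˡ y)) ⟩
    (x + y) * y    ≈⟨ distribʳ y x y ⟩
    x * y + y * y  ≈⟨ +-comm _ _ ⟩
    y * y + x * y  ∎)

  geometric-sum : ∀ x n → x * sumTo n (pow R (1# + x)) + 1# ≈ pow R (1# + x) n
  geometric-sum x zero    = trans (+-congʳ (zeroʳ x)) (+-identityˡ 1#)
  geometric-sum x (suc n) = begin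
    x * (1# + sumTo n (λ k → (1# + x) * pow R (1# + x) k)) + 1#
      ≈⟨ +-congʳ (*-congˡ (+-congˡ (sumTo-* n (1# + x) (pow R (1# + x))))) ⟩
    x * (1# + (1# + x) * G) + 1#
      ≈⟨ solve 2 (λ x G → x :* (con 1 :+ (con 1 :+ x) :* G) :+ con 1
                          := (con 1 :+ x) :* (x :* G :+ con 1)) refl x G ⟩
    (1# + x) * (x * G + 1#)
      ≈⟨ *-congˡ (geometric-sum x n) ⟩
    (1# + x) * pow R (1# + x) n ∎
    where G = sumTo n (pow R (1# + x))

  iter-suc≈φ-iter : ∀ p .{{_ : NonZero p}} F e s i j →
                    iter R p F e (suc s) i j ≈ φ R p (iter R p F e s) i j
  iter-suc≈φ-iter p F zero    s i j = refl
  iter-suc≈φ-iter p F (suc e) s i j = trans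
    (*-congʳ (iter-suc≈φ-iter p F e (suc s) (i / p) (j / p)))
    (sym (pow-distrib-* p _ _))

  module FiniteRing {q : ℕ} (card : Inverse (≡.setoid (Fin q)) setoid) where
    open Inverse card using (to; from; from-cong; inverseˡ; inverseʳ)

    to∘from : ∀ x → to (from x) ≈ x
    to∘from x = inverseˡ ≡.refl

    from∘to : ∀ i → from (to i) ≡ i
    from∘to i = inverseʳ refl

    ≈-dec : ∀ x y → Dec (x ≈ y)
    ≈-dec x y = map′
      (λ fx≡fy → trans (sym (to∘from x)) (trans (reflexive (≡.cong to fx≡fy)) (to∘from y)))
      from-cong (from x Fin.≟ from y)

    translate : Carrier → Fin q → Fin q
    translate a i = from (to i + a)

    translate-inverse : ∀ {a b} → a + b ≈ 0# → ∀ i → translate b (translate a i) ≡ i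
    translate-inverse {a} {b} a+b≈0 i = ≡.trans (from-cong (begin
      to (from (to i + a)) + b  ≈⟨ +-congʳ (to∘from _) ⟩
      (to i + a) + b            ≈⟨ +-assoc _ _ _ ⟩
      to i + (a + b)            ≈⟨ +-congˡ a+b≈0 ⟩
      to i + 0#                 ≈⟨ +-identityʳ _ ⟩
      to i                      ∎)) (from∘to i)

    -- The sum of all elements is invariant under the translation x ↦ x + 1.
    order×1≈0 : q × 1# ≈ 0#
    order×1≈0 = sym (∙-cancelʳ total 0# (q × 1#) (begin
      0# + total                    ≈⟨ +-identityˡ total ⟩
      total                         ≈⟨ ∑-permute to shift ⟩
      sum (λ i → to (translate 1# i)) ≈⟨ sum-cong-≋ (λ i → to∘from (to i + 1#)) ⟩
      sum (λ i → to i + 1#)         ≈⟨ ∑-distrib-+ to (λ _ → 1#) ⟩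
      total + sum {q} (λ _ → 1#)    ≈⟨ +-congˡ (sum-replicate q) ⟩
      total + q × 1#                ≈⟨ +-comm _ _ ⟩
      q × 1# + total                ∎))
      where
      total = sum {q} to
      shift = permutation (translate 1#) (translate (- 1#))
        (translate-inverse (-‿inverseˡ 1#)) (translate-inverse (-‿inverseʳ 1#))

  module FiniteField {q : ℕ} (F : IsFiniteFieldOfOrder R q) where
    open IsFiniteFieldOfOrder F
    open FiniteRing card

    nilpotent⇒≈0 : ∀ k x → pow R x k ≈ 0# → x ≈ 0#
    nilpotent⇒≈0 zero    x 1≈0 = contradiction 1≈0 one≉zero
    nilpotent⇒≈0 (suc k) x x¹⁺ᵏ≈0 with ≈-dec x 0#
    ... | yes x≈0 = x≈0
    ... | no  x≉0 with inverse x x≉0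
    ...   | y , xy≈1 = nilpotent⇒≈0 k x (begin
      pow R x k            ≈⟨ sym (*-identityˡ _) ⟩
      1# * pow R x k       ≈⟨ *-congʳ (trans (sym xy≈1) (*-comm x y)) ⟩
      (y * x) * pow R x k  ≈⟨ *-assoc _ _ _ ⟩
      y * pow R x (suc k)  ≈⟨ trans (*-congˡ x¹⁺ᵏ≈0) (zeroʳ y) ⟩
      0#                   ∎)

    characteristic : ∀ {p k} → q ≡ p ^ k → p × 1# ≈ 0#
    characteristic {p} {k} q≡pᵏ = nilpotent⇒≈0 k (p × 1#)
      (trans (sym (×1-homo-^ p k)) (≡.subst (λ n → n × 1# ≈ 0#) q≡pᵏ order×1≈0))

  module Characteristic {p : ℕ} (pr : Prime p) (char : p × 1# ≈ 0#) where

    p∣n⇒n×x≈0 : ∀ {n} → p ∣ n → ∀ x → n × x ≈ 0#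
    p∣n⇒n×x≈0 (divides n/p ≡.refl) x = begin
      (n/p ℕ.* p) × x    ≈⟨ reflexive (≡.cong (_× x) (ℕP.*-comm n/p p)) ⟩
      (p ℕ.* n/p) × x    ≈⟨ sym (×-assocˡ x p n/p) ⟩
      p × (n/p × x)      ≈⟨ ×≈×1#* p _ ⟩
      (p × 1#) * _       ≈⟨ trans (*-congʳ char) (zeroˡ _) ⟩
      0#                 ∎

    frobenius : ∀ x y → pow R (x + y) p ≈ pow R x p + pow R y p
    frobenius x y = begin
      pow R (x + y) p     ≈⟨ pow≈^ (x + y) p ⟩
      (x + y) ^ᴿ p        ≈⟨ binomial-theorem p x y ⟩
      sumTo (suc p) term  ≈⟨ sumTo-ends p term (ℕ.>-nonZero⁻¹ p {{prime⇒nonZero pr}})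
                               (λ k 0<k k<p → p∣n⇒n×x≈0 (prime∣pCk pr 0<k k<p) _) ⟩
      term 0 + term p     ≈⟨ +-comm _ _ ⟩
      term p + term 0     ≈⟨ +-cong term-p term-0 ⟩
      pow R x p + pow R y p ∎
      where
      term : ℕ → Carrier
      term k = (p C k) × (x ^ᴿ k * y ^ᴿ (p ∸ k))
      term-0 : term 0 ≈ pow R y p
      term-0 = trans (+-identityʳ _) (trans (*-identityˡ _) (sym (pow≈^ y p)))
      term-p : term p ≈ pow R x p
      term-p = begin
        term p                          ≈⟨ reflexive (≡.cong (_× (x ^ᴿ p * y ^ᴿ (p ∸ p))) (nCn≡1 p)) ⟩
        1 × (x ^ᴿ p * y ^ᴿ (p ∸ p))     ≈⟨ +-identityʳ _ ⟩
        x ^ᴿ p * y ^ᴿ (p ∸ p)           ≈⟨ reflexive (≡.cong (λ n → x ^ᴿ p * y ^ᴿ n) (ℕP.n∸n≡0 p)) ⟩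
        x ^ᴿ p * 1#                     ≈⟨ trans (*-identityʳ _) (sym (pow≈^ x p)) ⟩
        pow R x p                       ∎

  module Array (m : Carrier) where
    private
      a = arr R m
      c = 1# + m

    closedTerm : ℕ → ℕ → ℕ → Carrier
    closedTerm i j k = ((i C k) ℕ.* (j C k)) × pow R c k

    closedTerm-vanishes : ∀ i {j k} → j < k → closedTerm i j k ≈ 0#
    closedTerm-vanishes i {j} {k} j<k = reflexive (≡.cong (_× pow R c k)
      (≡.trans (≡.cong ((i C k) ℕ.*_) (k>n⇒nCk≡0 j<k)) (ℕP.*-zeroʳ (i C k))))

    closedTerm-recurrence : ∀ n i j →
      sumTo (suc n) (closedTerm (suc i) (suc j)) + sumTo (suc n) (closedTerm i j) ≈
      (sumTo (suc n) (closedTerm i (suc j)) + sumTo (suc n) (closedTerm (suc i) j)) +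
      c * sumTo n (closedTerm i j)
    closedTerm-recurrence n i j = begin
      sumTo (suc n) (closedTerm (suc i) (suc j)) + sumTo (suc n) (closedTerm i j)
        ≈⟨ sym (sumTo-+ (suc n) (closedTerm (suc i) (suc j)) (closedTerm i j)) ⟩
      sumTo (suc n) (λ k → closedTerm (suc i) (suc j) k + closedTerm i j k)
        ≈⟨ sumTo-cong (suc n) (λ k _ → termwise k) ⟩
      sumTo (suc n) (λ k → (closedTerm i (suc j) k + closedTerm (suc i) j k) + shifted k)
        ≈⟨ trans (sumTo-+ (suc n) (λ k → closedTerm i (suc j) k + closedTerm (suc i) j k) shifted)
                 (+-cong (sumTo-+ (suc n) (closedTerm i (suc j)) (closedTerm (suc i) j)) (+-identityˡ _)) ⟩
      (sumTo (suc n) (closedTerm i (suc j)) + sumTo (suc n) (closedTerm (suc i) j)) +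
      sumTo n (λ k → c * closedTerm i j k)
        ≈⟨ +-congˡ (sumTo-* n c (closedTerm i j)) ⟩
      (sumTo (suc n) (closedTerm i (suc j)) + sumTo (suc n) (closedTerm (suc i) j)) +
      c * sumTo n (closedTerm i j) ∎
      where
      shifted : ℕ → Carrier
      shifted zero    = 0#
      shifted (suc k) = c * closedTerm i j k
      termwise : ∀ k → closedTerm (suc i) (suc j) k + closedTerm i j k ≈
                       (closedTerm i (suc j) k + closedTerm (suc i) j k) + shifted k
      termwise zero    = sym (+-identityʳ _)
      termwise (suc k) = begin
        N₁₁ × x + N₀₀ × x                 ≈⟨ sym (×-homo-+ x N₁₁ N₀₀) ⟩
        (N₁₁ ℕ.+ N₀₀) × x                 ≈⟨ reflexive (≡.cong (_× x) (pascal-product i j k)) ⟩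
        ((N₀₁ ℕ.+ N₁₀) ℕ.+ N) × x          ≈⟨ trans (×-homo-+ x (N₀₁ ℕ.+ N₁₀) N)
                                                    (+-congʳ (×-homo-+ x N₀₁ N₁₀)) ⟩
        (N₀₁ × x + N₁₀ × x) + N × x        ≈⟨ +-congˡ (sym (×-comm-* N c (pow R c k))) ⟩
        (N₀₁ × x + N₁₀ × x) + c * closedTerm i j k ∎
        where
        x   = pow R c (suc k)
        N₁₁ = (suc i C suc k) ℕ.* (suc j C suc k)
        N₀₀ = (i C suc k) ℕ.* (j C suc k)
        N₀₁ = (i C suc k) ℕ.* (suc j C suc k)
        N₁₀ = (suc i C suc k) ℕ.* (j C suc k)
        N   = (i C k) ℕ.* (j C k)

    arr-closed : ∀ n i j → i < n → a i j ≈ sumTo n (closedTerm i j)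
    arr-closed (suc n) zero j _ = sym (begin
      closedTerm 0 j 0 + sumTo n (closedTerm 0 j ∘ suc)
        ≈⟨ +-cong (+-identityʳ 1#) (sumTo-zero n (closedTerm 0 j ∘ suc) (λ _ _ → refl)) ⟩
      1# + 0#  ≈⟨ +-identityʳ 1# ⟩
      1#       ∎)
    arr-closed (suc n) (suc i) zero _ = sym (begin
      closedTerm (suc i) 0 0 + sumTo n (closedTerm (suc i) 0 ∘ suc)
        ≈⟨ +-cong (+-identityʳ 1#) (sumTo-zero n (closedTerm (suc i) 0 ∘ suc)
                                      (λ k _ → closedTerm-vanishes (suc i) {0} {suc k} z<s)) ⟩
      1# + 0#  ≈⟨ +-identityʳ 1# ⟩
      1#       ∎)
    arr-closed (suc n) (suc i) (suc j) (s<s i<n) = ∙-cancelʳ (a i j) _ _ (begin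
      a (suc i) (suc j) + a i j
        ≈⟨ solve 4 (λ x y z μ → ((x :+ μ :* z) :+ y) :+ z := (x :+ y) :+ (con 1 :+ μ) :* z)
                   refl (a i (suc j)) (a (suc i) j) (a i j) m ⟩
      (a i (suc j) + a (suc i) j) + c * a i j
        ≈⟨ +-cong (+-cong (arr-closed (suc n) i (suc j) (ℕP.m<n⇒m<1+n i<n))
                          (arr-closed (suc n) (suc i) j (s<s i<n)))
                  (*-congˡ (arr-closed n i j i<n)) ⟩
      (sumTo (suc n) (closedTerm i (suc j)) + sumTo (suc n) (closedTerm (suc i) j)) +
      c * sumTo n (closedTerm i j)
        ≈⟨ sym (closedTerm-recurrence n i j) ⟩
      sumTo (suc n) (closedTerm (suc i) (suc j)) + sumTo (suc n) (closedTerm i j)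
        ≈⟨ +-congˡ (sym (arr-closed (suc n) i j (ℕP.m<n⇒m<1+n i<n))) ⟩
      sumTo (suc n) (closedTerm (suc i) (suc j)) + a i j ∎)

    arr-sym : ∀ i j → a i j ≈ a j i
    arr-sym i j = begin
      a i j                   ≈⟨ arr-closed n i j (s≤s (ℕP.m≤m+n i j)) ⟩
      sumTo n (closedTerm i j) ≈⟨ sumTo-cong n (λ k _ →
                                   reflexive (≡.cong (_× pow R c k) (ℕP.*-comm (i C k) (j C k)))) ⟩
      sumTo n (closedTerm j i) ≈⟨ sym (arr-closed n j i (s≤s (ℕP.m≤n+m j i))) ⟩
      a j i                   ∎
      where n = suc (i ℕ.+ j)

    module Lucas {P : ℕ} (pr : Prime (suc P)) (char : suc P × 1# ≈ 0#) where
      open Characteristic pr char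

      private
        p = suc P
        P<p = ℕP.n<1+n P

      arr-row-p : ∀ j → j < p → a p j ≈ 1#
      arr-row-p j j<p = begin
        a p j                                ≈⟨ arr-closed (suc p) p j (ℕP.n<1+n p) ⟩
        sumTo (suc p) (closedTerm p j)       ≈⟨ sumTo-ends p (closedTerm p j) z<s inner≈0 ⟩
        closedTerm p j 0 + closedTerm p j p  ≈⟨ +-cong (+-identityʳ 1#) (closedTerm-vanishes p j<p) ⟩
        1# + 0#                              ≈⟨ +-identityʳ 1# ⟩
        1#                                   ∎
        where
        inner≈0 : ∀ k → 0 < k → k < p → closedTerm p j k ≈ 0#
        inner≈0 k 0<k k<p = p∣n⇒n×x≈0 (∣m⇒∣m*n (j C k) (prime∣pCk pr 0<k k<p)) _

      arr-last-row-step : ∀ j → suc j < p → a P (suc j) + m * a P j ≈ 0#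
      arr-last-row-step j 1+j<p = ∙-cancelʳ (a p j) _ _ (trans
        (arr-row-p (suc j) 1+j<p)
        (sym (trans (+-identityˡ _) (arr-row-p j (ℕP.<-trans (ℕP.n<1+n j) 1+j<p)))))

      arr-last-col-step : ∀ i → suc i < p → a (suc i) P + m * a i P ≈ 0#
      arr-last-col-step i 1+i<p =
        trans (+-cong (arr-sym (suc i) P) (*-congˡ (arr-sym i P))) (arr-last-row-step i 1+i<p)

      binomial-square : ∀ k → k ≤ P → ((P C k) × 1#) * ((P C k) × 1#) ≈ 1#
      binomial-square zero    _     = trans (*-cong (+-identityʳ 1#) (+-identityʳ 1#)) (*-identityˡ 1#)
      binomial-square (suc k) 1+k≤P = trans (sum≈0⇒square≈square (begin
        (P C suc k) × 1# + (P C k) × 1#  ≈⟨ sym (×-homo-+ 1# (P C suc k) (P C k)) ⟩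
        ((P C suc k) ℕ.+ (P C k)) × 1#   ≈⟨ reflexive (≡.cong (_× 1#) (≡.trans (ℕP.+-comm (P C suc k) _)
                                                                  (nCk+nC[k+1]≡[n+1]C[k+1] P k))) ⟩
        (p C suc k) × 1#                 ≈⟨ p∣n⇒n×x≈0 (prime∣pCk pr z<s (s≤s 1+k≤P)) 1# ⟩
        0#                               ∎)) (binomial-square k (ℕP.<⇒≤ 1+k≤P))

      arr-last-diagonal : m * a P P ≈ pow R m p
      arr-last-diagonal = ∙-cancelʳ 1# _ _ (begin
        m * a P P + 1#               ≈⟨ +-congʳ (*-congˡ (trans (arr-closed p P P P<p) (sumTo-cong p term≈cᵏ))) ⟩
        m * sumTo p (pow R c) + 1#   ≈⟨ geometric-sum m p ⟩
        pow R c p                    ≈⟨ frobenius 1# m ⟩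
        pow R 1# p + pow R m p       ≈⟨ trans (+-congʳ (pow-1# p)) (+-comm _ _) ⟩
        pow R m p + 1#               ∎)
        where
        term≈cᵏ : ∀ k → k < p → closedTerm P P k ≈ pow R c k
        term≈cᵏ k (s≤s k≤P) = begin
          ((P C k) ℕ.* (P C k)) × pow R c k      ≈⟨ ×≈×1#* ((P C k) ℕ.* (P C k)) (pow R c k) ⟩
          (((P C k) ℕ.* (P C k)) × 1#) * pow R c k ≈⟨ *-congʳ (trans (×1-homo-* (P C k) _)
                                                                     (binomial-square k k≤P)) ⟩
          1# * pow R c k                         ≈⟨ *-identityˡ _ ⟩
          pow R c k                              ∎

      private
        Φ = φ R p a

        recurrence-cong : ∀ {x₁ x₂ x₃ y₁ y₂ y₃} → x₁ ≈ y₁ → x₂ ≈ y₂ → x₃ ≈ y₃ →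
                          (x₁ + m * x₂) + x₃ ≈ (y₁ + m * y₂) + y₃
        recurrence-cong x₁≈y₁ x₂≈y₂ x₃≈y₃ = +-cong (+-cong x₁≈y₁ (*-congˡ x₂≈y₂)) x₃≈y₃

        factorˡ : ∀ x y z → x * y + m * (x * z) ≈ x * (y + m * z)
        factorˡ x y z = solve 4 (λ x y z μ → x :* y :+ μ :* (x :* z) := x :* (y :+ μ :* z)) refl x y z m

        interior-step : ∀ x y₁ y₂ y₃ → (x * y₁ + m * (x * y₂)) + x * y₃ ≈ x * ((y₁ + m * y₂) + y₃)
        interior-step x y₁ y₂ y₃ = trans (+-congʳ (factorˡ x y₁ y₂)) (sym (distribˡ x _ y₃))

        row-edge-step : ∀ x y j → suc j < p → (x * a P (suc j) + m * (x * a P j)) + y ≈ y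
        row-edge-step x y j 1+j<p = trans
          (+-congʳ (trans (factorˡ x _ _) (trans (*-congˡ (arr-last-row-step j 1+j<p)) (zeroʳ x))))
          (+-identityˡ y)

        col-edge-step : ∀ x y i → suc i < p → (y * a i 0 + m * (x * a i P)) + x * a (suc i) P ≈ y
        col-edge-step x y i 1+i<p = begin
          (y * a i 0 + m * (x * a i P)) + x * a (suc i) P  ≈⟨ trans (+-assoc _ _ _) (+-congˡ (+-comm _ _)) ⟩
          y * a i 0 + (x * a (suc i) P + m * (x * a i P))  ≈⟨ +-congˡ (factorˡ x _ _) ⟩
          y * a i 0 + x * (a (suc i) P + m * a i P)        ≈⟨ +-cong (*-congˡ (arr-sym i 0))
                                                                      (*-congˡ (arr-last-col-step i 1+i<p)) ⟩
          y * 1# + x * 0#                                  ≈⟨ +-cong (*-identityʳ y) (zeroʳ x) ⟩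
          y + 0#                                           ≈⟨ +-identityʳ y ⟩
          y                                                ∎

        corner-step : ∀ I J →
          (Φ I (suc J) * a P 0 + m * (Φ I J * a P P)) + Φ (suc I) J * 1# ≈ Φ (suc I) (suc J)
        corner-step I J = begin
          (Φ I (suc J) * a P 0 + m * (Φ I J * a P P)) + Φ (suc I) J * 1#
            ≈⟨ +-cong (+-cong (trans (*-congˡ (arr-sym P 0)) (*-identityʳ _)) (x∙yz≈y∙xz m _ _))
                      (*-identityʳ _) ⟩
          (Φ I (suc J) + Φ I J * (m * a P P)) + Φ (suc I) J
            ≈⟨ +-congʳ (+-congˡ (trans (*-congˡ arr-last-diagonal) (*-comm _ _))) ⟩
          (Φ I (suc J) + pow R m p * Φ I J) + Φ (suc I) J
            ≈⟨ +-congʳ (+-congˡ (sym (pow-distrib-* p m (a I J)))) ⟩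
          (Φ I (suc J) + pow R (m * a I J) p) + Φ (suc I) J
            ≈⟨ +-congʳ (sym (frobenius _ _)) ⟩
          pow R (a I (suc J) + m * a I J) p + Φ (suc I) J
            ≈⟨ sym (frobenius _ _) ⟩
          Φ (suc I) (suc J) ∎

      arr-block : ∀ I i J j → i < p → j < p → a (i ℕ.+ I ℕ.* p) (j ℕ.+ J ℕ.* p) ≈ Φ I J * a i j
      arr-block zero zero J j _ _ = sym (trans (*-identityʳ _) (pow-1# p))
      arr-block I i zero zero _ _ = begin
        a (i ℕ.+ I ℕ.* p) 0  ≈⟨ arr-sym (i ℕ.+ I ℕ.* p) 0 ⟩
        1#                   ≈⟨ sym (trans (*-cong (trans (pow-congˡ p (arr-sym I 0)) (pow-1# p))
                                                   (arr-sym i 0))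
                                           (*-identityˡ 1#)) ⟩
        Φ I 0 * a i 0        ∎
      arr-block I (suc i) J (suc j) 1+i<p 1+j<p = trans
        (recurrence-cong (arr-block I i J (suc j) i<p 1+j<p) (arr-block I i J j i<p j<p)
                         (arr-block I (suc i) J j 1+i<p j<p))
        (interior-step (Φ I J) _ _ _)
        where
        i<p = ℕP.<-trans (ℕP.n<1+n i) 1+i<p
        j<p = ℕP.<-trans (ℕP.n<1+n j) 1+j<p
      arr-block (suc I) zero J (suc j) _ 1+j<p = trans
        (recurrence-cong (arr-block I P J (suc j) P<p 1+j<p) (arr-block I P J j P<p j<p)
                         (arr-block (suc I) zero J j z<s j<p))
        (row-edge-step (Φ I J) (Φ (suc I) J * a 0 (suc j)) j 1+j<p)
        where
        j<p = ℕP.<-trans (ℕP.n<1+n j) 1+j<p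
      arr-block I (suc i) (suc J) zero 1+i<p _ = trans
        (recurrence-cong (arr-block I i (suc J) zero i<p z<s) (arr-block I i J P i<p P<p)
                         (arr-block I (suc i) J P 1+i<p P<p))
        (trans (col-edge-step (Φ I J) (Φ I (suc J)) i 1+i<p) (sym (*-identityʳ _)))
        where
        i<p = ℕP.<-trans (ℕP.n<1+n i) 1+i<p
      arr-block (suc I) zero (suc J) zero _ _ = trans
        (recurrence-cong (arr-block I P (suc J) zero P<p z<s) (arr-block I P J P P<p P<p)
                         (arr-block (suc I) zero J P z<s P<p))
        (trans (corner-step I J) (sym (*-identityʳ _)))

      arr≈tensor : ∀ i j → a i j ≈ tensor R p p Φ a i j
      arr≈tensor i j = trans
        (reflexive (≡.cong₂ a (m≡m%n+[m/n]*n i p) (m≡m%n+[m/n]*n j p)))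
        (arr-block (i / p) (i % p) (j / p) (j % p) (m%n<n i p) (m%n<n j p))

      arr≈rhs : ∀ e i j → i < p ^ suc e → j < p ^ suc e → a i j ≈ rhs R p a e i j
      arr≈rhs zero    i j _ _ = refl
      arr≈rhs (suc e) i j i<pᵉ⁺² j<pᵉ⁺² = begin
        a i j
          ≈⟨ arr≈tensor i j ⟩
        Φ (i / p) (j / p) * a (i % p) (j % p)
          ≈⟨ *-congʳ (pow-congˡ p (arr≈rhs e (i / p) (j / p) (quotient< i<pᵉ⁺²) (quotient< j<pᵉ⁺²))) ⟩
        φ R p (rhs R p a e) (i / p) (j / p) * a (i % p) (j % p)
          ≈⟨ *-congʳ (sym (iter-suc≈φ-iter p a e 0 _ _)) ⟩
        rhs R p a (suc e) i j ∎
        where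
        quotient< : ∀ {x} → x < p ^ suc (suc e) → x / p < p ^ suc e
        quotient< {x} x<pᵉ⁺² = m<n*o⇒m/o<n (≡.subst (x <_) (ℕP.*-comm p (p ^ suc e)) x<pᵉ⁺²)

theorem3p7 : {c ℓ : Level} (p : ℕ) .{{_ : NonZero p}} → Prime p →
    (k q : ℕ) → q ≡ p ^ k →
    (R : CommutativeRing c ℓ) → IsFiniteFieldOfOrder R q →
    (m : CommutativeRing.Carrier R) →
    (d : ℕ) → 1 ≤ d → (i j : ℕ) → i < p ^ d → j < p ^ d →
    CommutativeRing._≈_ R (arr R m i j)
      (rhs R p (arr R m) (d ∸ 1) i j)
theorem3p7 zero pr _ _ _ _ _ _ _ _ _ _ _ _ = ⊥-elim (ℕ.NonZero.nonZero (prime⇒nonZero pr))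
theorem3p7 (suc P) pr k q q≡pᵏ R F m (suc e) (s≤s z≤n) i j i<pᵈ j<pᵈ =
  Array.Lucas.arr≈rhs R m pr (FiniteField.characteristic R F {suc P} {k} q≡pᵏ) e i j i<pᵈ j<pᵈ
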